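{- Let $H$ be any disconnected (finite, simple) graph. Then there are infinitely many pairwise non-isomorphic graphs $G$ such that the $\operatorname{IR}$-graph $G(\operatorname{IR})$ is isomorphic to $H$.
   Context: All graphs are finite and simple. For a graph $G=(V,E)$ and $D\subseteq V$, $v\in D$, the private neighbourhood of $v$ with respect to $D$ is $\operatorname{PN}(v,D)=N[v]-N[D-\{v\}]$, where $N[v]$ is the closed neighbourhood of $v$ and $N[S]=\bigcup_{s\in S}N[s]$. A set $D$ is irredundant if $\operatorname{PN}(v,D)\neq\varnothing$ for every $v\in D$. $\operatorname{IR}(G)$ is the maximum cardinality of an irredundant set of $G$, and an $\operatorname{IR}(G)$-set (or $\operatorname{IR}$-set) is an irredundant set of cardinality $\operatorname{IR}(G)$. The $\operatorname{IR}$-graph $G(\operatorname{IR})$ of $G$ has the $\operatorname{IR}(G)$-sets as vertices, and two $\operatorname{IR}(G)$-sets $D,D'$ are adjacent iff there exist $u\in D$, $v\in D'$ with $uv\in E(G)$ and $D'=(D-\{u\})\cup\{v\}$. -}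

module Defs where

open import Data.Nat using (ℕ; _≤_)
open import Data.Bool using (Bool; true; false)
open import Data.Fin using (Fin)
open import Data.Fin.Subset using (Subset; _∈_; _∉_; _-_; _∪_; ⁅_⁆; ∣_∣)
open import Data.Product using (Σ; ∃; ∃-syntax; _×_; _,_)
open import Data.Sum using (_⊎_)
open import Relation.Nullary using (¬_)
open import Relation.Binary.PropositionalEquality using (_≡_; _≢_)
open import Relation.Binary.Construct.Closure.ReflexiveTransitive using (Star)
open import Function.Bundles using (_⇔_)

record Graph : Set where
  field
    order : ℕ
    adj   : Fin order → Fin order → Bool
    sym   : ∀ u v → adj u v ≡ adj v u
    irrefl : ∀ v → adj v v ≡ false

open Graph public

Adj : (G : Graph) → Fin (order G) → Fin (order G) → Set
Adj G u v = adj G u v ≡ true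

Reachable : (G : Graph) → Fin (order G) → Fin (order G) → Set
Reachable G = Star (Adj G)

Connected : Graph → Set
Connected G = ∀ u v → Reachable G u v

Disconnected : Graph → Set
Disconnected G = ¬ Connected G

record _≅_ (G H : Graph) : Set where
  field
    to      : Fin (order G) → Fin (order H)
    from    : Fin (order H) → Fin (order G)
    from∘to : ∀ v → from (to v) ≡ v
    to∘from : ∀ w → to (from w) ≡ w
    adj-pres : ∀ u v → adj G u v ≡ adj H (to u) (to v)

InClosedNbhd : (G : Graph) → Fin (order G) → Fin (order G) → Set
InClosedNbhd G v w = (w ≡ v) ⊎ Adj G v w

InPrivateNbhd : (G : Graph) → Subset (order G) → Fin (order G) → Fin (order G) → Set
InPrivateNbhd G D v w =
  InClosedNbhd G v w × (∀ u → u ∈ D → u ≢ v → ¬ InClosedNbhd G u w)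

Irredundant : (G : Graph) → Subset (order G) → Set
Irredundant G D = ∀ v → v ∈ D → ∃[ w ] InPrivateNbhd G D v w

IRSet : (G : Graph) → Subset (order G) → Set
IRSet G D = Irredundant G D × (∀ D' → Irredundant G D' → ∣ D' ∣ ≤ ∣ D ∣)

IRAdj : (G : Graph) → Subset (order G) → Subset (order G) → Set
IRAdj G D D' = ∃[ u ] ∃[ v ]
  (u ∈ D × v ∈ D' × Adj G u v × D' ≡ ((D - u) ∪ ⁅ v ⁆))

IRGraphIso : (G H : Graph) → Set
IRGraphIso G H =
  Σ (Fin (order H) → Subset (order G)) λ f →
    (∀ i → IRSet G (f i)) ×
    (∀ i j → f i ≡ f j → i ≡ j) ×
    (∀ D → IRSet G D → ∃[ i ] f i ≡ D) ×
    (∀ i j → Adj H i j ⇔ IRAdj G (f i) (f j))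

module Submission where

-- Being disconnected, H has a split: a Boolean colouring `side` that is
-- constant along edges and uses both colours (colour one component, found by
-- iterating reachability until it stabilises).  For m ≥ n + 2, n = |V(H)|,
-- let G consist of a copy X i of each vertex of H and two m-cliques C true,
-- C false joined by a perfect matching; the copies carry the edges of H plus
-- all edges between the two sides, and X i is joined to the clique C (side i).
-- The canonical sets {X i} ∪ C (side i) are irredundant of size m + 1.  An
-- irredundant set meeting a clique twice is "concentrated" (it avoids the
-- other clique and has at most one copy, on the right side) and so has at most
-- m + 1 vertices, with equality only for a canonical set; otherwise it has at
-- most n + 2 ≤ m vertices.  Hence the IR-sets are exactly the canonical sets,
-- and two of them differ by one exchange along an edge iff the corresponding
-- vertices of H are adjacent.  Taking m = n + 2 + k gives graphs of pairwise
-- different orders n + 2m.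

open import Defs
open import Data.Nat using (ℕ; zero; suc; _+_; _≤_; _<_; z≤n; s≤s; s≤s⁻¹)
open import Data.Nat.Properties
  using (≤-refl; ≤-trans; ≤-reflexive; ≤-antisym; <⇒≱; ≰⇒>; _≤?_; n≤1+n; n<1+n;
         +-mono-≤; +-monoˡ-≤; +-monoʳ-≤; +-cancelʳ-≤; +-cancelˡ-≤; +-cancelˡ-≡; +-identityʳ; +-comm; +-assoc;
         +-suc; m≤m+n; m≤n+m) renaming (suc-injective to ℕ-suc-injective)
open import Data.Bool using (Bool; true; false; not; _∨_; _xor_)
open import Data.Bool.Properties using (¬-not; not-¬; ∨-zeroʳ; ∨-identityʳ) renaming (_≟_ to _≟ᵇ_)
open import Data.Fin using (Fin; zero; suc; _↑ˡ_; _↑ʳ_; _≟_; splitAt; fromℕ<)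
open import Data.Fin.Properties using (0≢1+n; suc-injective; any?; all?; ¬∀⟶∃¬;
         splitAt-↑ˡ; splitAt-↑ʳ; splitAt⁻¹-↑ˡ; splitAt⁻¹-↑ʳ; injective⇒≤)
open import Data.Fin.Subset using (Subset; ∣_∣; _∈_; _∉_; _─_; _-_; _∪_; ⁅_⁆)
open import Data.Fin.Subset.Properties
  using (x∈p∪q⁺; x∈p∪q⁻; x∈p∧x≢y⇒x∈p-y; p─q⊆p; x∈⁅x⁆; x∈⁅y⁆⇒x≡y; x∉⁅y⁆⇒x≢y; ⊆-antisym)
open import Data.Vec using ([]; _∷_; there; lookup; tabulate)
open import Data.Vec.Properties using (lookup⇒[]=; []=⇒lookup; lookup∘tabulate; tabulate∘lookup; tabulate-cong)
open import Data.Product using (Σ; _×_; ∃-syntax; _,_; proj₁; proj₂)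
open import Data.Sum using (_⊎_; inj₁; inj₂)
open import Data.Empty using (⊥-elim)
open import Function using (_∘_)
open import Function.Bundles using (mk⇔)
open import Relation.Nullary using (¬_; Dec; yes; no; does)
open import Relation.Nullary.Decidable using (dec-true; dec-false; _×-dec_; _→-dec_)
open import Relation.Binary.Definitions using (DecidableEquality)
open import Relation.Binary.Construct.Closure.ReflexiveTransitive using (ε; _◅_; _◅◅_; reverse)
open import Relation.Binary.PropositionalEquality
  using (_≡_; _≢_; refl; trans; cong; cong₂; subst; module ≡-Reasoning) renaming (sym to ≡-sym)

indicator : Bool → ℕ
indicator true  = 1
indicator false = 0

count : ∀ {N} → (Fin N → Bool) → ℕ
count {zero}  p = 0
count {suc N} p = indicator (p zero) + count (p ∘ suc)

count-≤ : ∀ {N} (p : Fin N → Bool) → count p ≤ N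
count-≤ {zero}  p = z≤n
count-≤ {suc N} p = +-mono-≤ (indicator≤1 (p zero)) (count-≤ (p ∘ suc))
  where
  indicator≤1 : ∀ b → indicator b ≤ 1
  indicator≤1 true  = s≤s z≤n
  indicator≤1 false = z≤n

count-cong : ∀ {N} {p q : Fin N → Bool} → (∀ x → p x ≡ q x) → count p ≡ count q
count-cong {zero}  e = refl
count-cong {suc N} e = cong₂ _+_ (cong indicator (e zero)) (count-cong (e ∘ suc))

indicator-mono : ∀ {a b} → (a ≡ true → b ≡ true) → indicator a ≤ indicator b
indicator-mono {false} _  = z≤n
indicator-mono {true}  ab rewrite ab refl = ≤-refl

count-mono : ∀ {N} {p q : Fin N → Bool} → (∀ x → p x ≡ true → q x ≡ true) → count p ≤ count q
count-mono {zero}  _   = z≤n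
count-mono {suc N} p⊆q = +-mono-≤ (indicator-mono (p⊆q zero)) (count-mono (p⊆q ∘ suc))

count-strict : ∀ {N} {p q : Fin N → Bool} → (∀ x → p x ≡ true → q x ≡ true) →
  ∀ x → p x ≡ false → q x ≡ true → count p < count q
count-strict {suc N} {p} {q} p⊆q zero px qx rewrite px | qx = s≤s (count-mono (p⊆q ∘ suc))
count-strict {suc N} {p} {q} p⊆q (suc x) px qx =
  subst (_≤ count q) (+-suc (indicator (p zero)) (count (p ∘ suc)))
    (+-mono-≤ (indicator-mono (p⊆q zero)) (count-strict (p⊆q ∘ suc) x px qx))

count-split : ∀ a {b} (p : Fin (a + b) → Bool) →
  count p ≡ count (p ∘ (_↑ˡ b)) + count (p ∘ (a ↑ʳ_))
count-split zero    p = refl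
count-split (suc a) p =
  trans (cong (indicator (p zero) +_) (count-split a (p ∘ suc)))
        (≡-sym (+-assoc (indicator (p zero)) _ _))

count-none : ∀ {N} (p : Fin N → Bool) → (∀ x → p x ≡ false) → count p ≡ 0
count-none {zero}  p none = refl
count-none {suc N} p none rewrite none zero = count-none (p ∘ suc) (none ∘ suc)

count-all : ∀ {N} (p : Fin N → Bool) → (∀ x → p x ≡ true) → count p ≡ N
count-all {zero}  p all = refl
count-all {suc N} p all rewrite all zero = cong suc (count-all (p ∘ suc) (all ∘ suc))

count-full : ∀ {N} (p : Fin N → Bool) → N ≤ count p → ∀ x → p x ≡ true
count-full {suc N} p full x with p zero in p0
count-full {suc N} p full       zero    | true  = p0
count-full {suc N} p (s≤s full) (suc x) | true  = count-full (p ∘ suc) full x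
count-full {suc N} p full       x       | false = ⊥-elim (<⇒≱ (s≤s (count-≤ (p ∘ suc))) full)

count-≤1 : ∀ {N} (p : Fin N → Bool) → (∀ x y → p x ≡ true → p y ≡ true → x ≡ y) → count p ≤ 1
count-≤1 {zero}  p unique = z≤n
count-≤1 {suc N} p unique with p zero in p0
... | true  = s≤s (≤-reflexive (count-none (p ∘ suc) λ x →
                ¬-not λ px → 0≢1+n (unique zero (suc x) p0 px)))
... | false = count-≤1 (p ∘ suc) λ x y px py → suc-injective (unique (suc x) (suc y) px py)

count-≥1 : ∀ {N} (p : Fin N → Bool) x → p x ≡ true → 1 ≤ count p
count-≥1 {N} p x px = subst (λ c → suc c ≤ count p) (count-none {N} (λ _ → false) λ _ → refl)
  (count-strict {N} {p = λ _ → false} (λ _ ()) x refl px)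

count-witness : ∀ {N} (p : Fin N → Bool) → 1 ≤ count p → ∃[ x ] p x ≡ true
count-witness {suc N} p pos with p zero in p0
... | true  = zero , p0
... | false with count-witness (p ∘ suc) pos
...   | x , px = suc x , px

count-two : ∀ {N} (p : Fin N → Bool) → 2 ≤ count p →
  ∃[ x ] ∃[ y ] (x ≢ y × p x ≡ true × p y ≡ true)
count-two {suc N} p two with p zero in p0
count-two {suc N} p (s≤s two) | true with count-witness (p ∘ suc) two
... | y , py = zero , suc y , 0≢1+n , p0 , py
count-two {suc N} p two | false with count-two (p ∘ suc) two
... | x , y , x≢y , px , py = suc x , suc y , x≢y ∘ suc-injective , px , py

∣∣≡count : ∀ {N} (D : Subset N) → ∣ D ∣ ≡ count (lookup D)
∣∣≡count []          = refl
∣∣≡count (true ∷ D)  = cong suc (∣∣≡count D)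
∣∣≡count (false ∷ D) = ∣∣≡count D

sum-tight : ∀ {a b x y} → a ≤ x → b ≤ y → a + b ≡ x + y → (a ≡ x) × (b ≡ y)
sum-tight {a} {b} {x} {y} a≤x b≤y e =
  ≤-antisym a≤x (+-cancelʳ-≤ y x a (subst (_≤ a + y) e (+-monoʳ-≤ a b≤y))) ,
  ≤-antisym b≤y (+-cancelˡ-≤ x y b (subst (_≤ x + b) e (+-monoˡ-≤ b a≤x)))

r≢not-r : ∀ {r} → r ≢ not r
r≢not-r = not-¬ refl

bool-cases : ∀ a b → (a ≡ b) ⊎ (a ≡ not b)
bool-cases a b with a ≟ᵇ b
... | yes a≡b = inj₁ a≡b
... | no  a≢b = inj₂ (¬-not a≢b)

bool-ext : ∀ {a b : Bool} → (a ≡ true → b ≡ true) → (b ≡ true → a ≡ true) → a ≡ b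
bool-ext {true}          ab _  = ≡-sym (ab refl)
bool-ext {false} {false} _  _  = refl
bool-ext {false} {true}  _  ba = ba refl

does-sound : ∀ {A : Set} (a? : Dec A) → does a? ≡ true → A
does-sound (yes a) _ = a

does-sym : ∀ {A : Set} (_≟_ : DecidableEquality A) x y → does (x ≟ y) ≡ does (y ≟ x)
does-sym _≟_ x y with x ≟ y | y ≟ x
... | yes _   | yes _   = refl
... | no  _   | no  _   = refl
... | yes x≡y | no  y≢x = ⊥-elim (y≢x (≡-sym x≡y))
... | no  x≢y | yes y≡x = ⊥-elim (x≢y (≡-sym y≡x))

true-and-false : ∀ {a b : Bool} → ¬ (a ≡ true → b ≡ true) → (a ≡ true) × (b ≡ false)
true-and-false {true}  {false} _ = refl , refl
true-and-false {true}  {true}  h = ⊥-elim (h λ _ → refl)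
true-and-false {false}         h = ⊥-elim (h λ ())

record Split (H : Graph) : Set where
  field
    side         : Fin (order H) → Bool
    true-vertex  : Fin (order H)
    true-side    : side true-vertex ≡ true
    false-vertex : Fin (order H)
    false-side   : side false-vertex ≡ false
    side-edge    : ∀ i j → Adj H i j → side i ≡ side j

-- Reachability from a fixed vertex u is decidable: `within k w` holds when w
-- is reachable from u by a walk of length at most k, and these sets become
-- stationary after at most (order H) steps since their counts grow strictly.
module Reachability (H : Graph) (u : Fin (order H)) where

  step? : (S : Fin (order H) → Bool) (w : Fin (order H)) → Dec (∃[ v ] (S v ≡ true × Adj H v w))
  step? S w = any? λ v → (S v ≟ᵇ true) ×-dec (adj H v w ≟ᵇ true)

  within : ℕ → Fin (order H) → Bool
  within zero    w = does (u ≟ w)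
  within (suc k) w = within k w ∨ does (step? (within k) w)

  within-sound : ∀ k w → within k w ≡ true → Reachable H u w
  within-sound zero    w e = subst (Reachable H u) (does-sound (u ≟ w) e) ε
  within-sound (suc k) w e with within k w in wk
  ... | true  = within-sound k w wk
  ... | false with does-sound (step? (within k) w) e
  ...   | v , kv , vw = within-sound k v kv ◅◅ (vw ◅ ε)

  within-suc : ∀ k w → within k w ≡ true → within (suc k) w ≡ true
  within-suc k w e rewrite e = refl

  within-start : ∀ k → within k u ≡ true
  within-start zero    = dec-true (u ≟ u) refl
  within-start (suc k) = within-suc k u (within-start k)

  within-step : ∀ k v w → within k v ≡ true → Adj H v w → within (suc k) w ≡ true
  within-step k v w kv vw =
    trans (cong (within k w ∨_) (dec-true (step? (within k) w) (v , kv , vw))) (∨-zeroʳ (within k w))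

  Stationary : ℕ → Set
  Stationary k = ∀ w → within (suc k) w ≡ true → within k w ≡ true

  settled? : ∀ k w → Dec (within (suc k) w ≡ true → within k w ≡ true)
  settled? k w = (within (suc k) w ≟ᵇ true) →-dec (within k w ≟ᵇ true)

  grows : ∀ j → (∃[ k ] Stationary k) ⊎ (j ≤ count (within j))
  grows zero = inj₂ z≤n
  grows (suc j) with grows j
  ... | inj₁ st = inj₁ st
  ... | inj₂ big with all? (settled? j)
  ...   | yes st = inj₁ (j , st)
  ...   | no ¬st with ¬∀⟶∃¬ (order H) _ (settled? j) ¬st
  ...     | w , new with true-and-false new
  ...       | now , before = inj₂ (≤-trans (s≤s big) (count-strict (within-suc j) w before now))

  -- Counts are bounded by order H, so the sets must become stationary.
  stationary : ∃[ k ] Stationary k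
  stationary with grows (suc (order H))
  ... | inj₁ st  = st
  ... | inj₂ big = ⊥-elim (<⇒≱ (s≤s (count-≤ (within (suc (order H))))) big)

  radius : ℕ
  radius = proj₁ stationary

  component : Fin (order H) → Bool
  component = within radius

  component-closed : ∀ v w → component v ≡ true → Adj H v w → component w ≡ true
  component-closed v w cv vw = proj₂ stationary w (within-step radius v w cv vw)

-- A graph without vertices is connected, so a disconnected graph has a vertex.
some-vertex : (H : Graph) → Disconnected H → Fin (order H)
some-vertex H dis = pick (order H) dis
  where
  pick : ∀ N {P : Fin N → Fin N → Set} → ¬ (∀ u v → P u v) → Fin N
  pick zero    h = ⊥-elim (h λ ())
  pick (suc N) h = zero

-- Every disconnected graph splits: colour the component of some vertex.
disconnected⇒split : (H : Graph) → Disconnected H → Split H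
disconnected⇒split H dis = record
  { side = component ; true-vertex = u ; true-side = within-start radius
  ; false-vertex = proj₁ outside ; false-side = proj₂ outside ; side-edge = side-edge }
  where
  u : Fin (order H)
  u = some-vertex H dis
  open Reachability H u

  symmetric : ∀ {x y} → Adj H x y → Adj H y x
  symmetric {x} {y} a = trans (Graph.sym H y x) a

  -- If the component were everything, every two vertices would be joined via u.
  not-all : ¬ (∀ w → component w ≡ true)
  not-all all = dis λ x y →
    reverse symmetric (within-sound radius x (all x)) ◅◅ within-sound radius y (all y)

  outside : ∃[ w ] component w ≡ false
  outside with ¬∀⟶∃¬ (order H) (λ w → component w ≡ true) (λ w → component w ≟ᵇ true) not-all
  ... | w , w∉ = w , ¬-not w∉

  side-edge : ∀ i j → Adj H i j → component i ≡ component j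
  side-edge i j a with component i in ci | component j in cj
  ... | true  | true  = refl
  ... | false | false = refl
  ... | true  | false = trans (≡-sym (component-closed i j ci a)) cj
  ... | false | true  = trans (≡-sym ci) (component-closed j i cj (symmetric a))

-- Closed
-- neighbourhoods, private neighbours and irredundance are computed on V, with
-- vertex sets given as Boolean predicates, and transferred to the Graph.
module Presented {V : Set} {N : ℕ} (enc : V → Fin N) (dec : Fin N → V)
                 (dec∘enc : ∀ s → dec (enc s) ≡ s) (enc∘dec : ∀ v → enc (dec v) ≡ v)
                 (adjV : V → V → Bool) (adjV-sym : ∀ s t → adjV s t ≡ adjV t s)
                 (adjV-irrefl : ∀ s → adjV s s ≡ false) where

  graph : Graph
  graph = record
    { order  = N
    ; adj    = λ u v → adjV (dec u) (dec v)
    ; sym    = λ u v → adjV-sym (dec u) (dec v)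
    ; irrefl = λ v → adjV-irrefl (dec v) }

  enc-injective : ∀ {s t} → enc s ≡ enc t → s ≡ t
  enc-injective {s} {t} e = trans (≡-sym (dec∘enc s)) (trans (cong dec e) (dec∘enc t))

  adj-enc : ∀ s t → adj graph (enc s) (enc t) ≡ adjV s t
  adj-enc s t = cong₂ adjV (dec∘enc s) (dec∘enc t)

  by-vertex : ∀ {P : Fin N → Set} → (∀ s → P (enc s)) → ∀ v → P v
  by-vertex {P} h v = subst P (enc∘dec v) (h (dec v))

  NbhdV : V → V → Set
  NbhdV s t = (t ≡ s) ⊎ (adjV s t ≡ true)

  PrivateV : (V → Bool) → V → V → Set
  PrivateV D s t = NbhdV s t × (∀ s′ → D s′ ≡ true → s′ ≢ s → ¬ NbhdV s′ t)

  IrredundantV : (V → Bool) → Set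
  IrredundantV D = ∀ s → D s ≡ true → ∃[ t ] PrivateV D s t

  IrredundantV-cong : ∀ {D D′} → (∀ s → D s ≡ D′ s) → IrredundantV D → IrredundantV D′
  IrredundantV-cong D≗D′ irr s s∈ with irr s (trans (D≗D′ s) s∈)
  ... | t , near , alone = t , near , λ s′ s′∈ → alone s′ (trans (D≗D′ s′) s′∈)

  nbhd⇒ : ∀ {v w} → InClosedNbhd graph v w → NbhdV (dec v) (dec w)
  nbhd⇒ (inj₁ w≡v) = inj₁ (cong dec w≡v)
  nbhd⇒ (inj₂ vw)  = inj₂ vw

  nbhd⇐ : ∀ {v w} → NbhdV (dec v) (dec w) → InClosedNbhd graph v w
  nbhd⇐ {v} {w} (inj₁ w≡v) = inj₁ (trans (≡-sym (enc∘dec w)) (trans (cong enc w≡v) (enc∘dec v)))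
  nbhd⇐ (inj₂ vw) = inj₂ vw

  restrict : Subset N → V → Bool
  restrict D s = lookup D (enc s)

  toSubset : (V → Bool) → Subset N
  toSubset S = tabulate (S ∘ dec)

  restrict-toSubset : ∀ S s → restrict (toSubset S) s ≡ S s
  restrict-toSubset S s = trans (lookup∘tabulate (S ∘ dec) (enc s)) (cong S (dec∘enc s))

  toSubset-restrict : ∀ {D S} → (∀ s → restrict D s ≡ S s) → toSubset S ≡ D
  toSubset-restrict {D} {S} D≗S =
    trans (tabulate-cong (λ v → ≡-sym (by-vertex {λ v → lookup D v ≡ S (dec v)}
                                  (λ s → trans (D≗S s) (cong S (≡-sym (dec∘enc s)))) v)))
          (tabulate∘lookup D)

  restrict⇒∈ : ∀ {D s} → restrict D s ≡ true → enc s ∈ D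
  restrict⇒∈ = lookup⇒[]= _ _

  ∈⇒restrict : ∀ {D v} → v ∈ D → restrict D (dec v) ≡ true
  ∈⇒restrict {D} {v} v∈ = trans (cong (lookup D) (enc∘dec v)) ([]=⇒lookup v∈)

  ∈-toSubset : ∀ S s → enc s ∈ toSubset S → S s ≡ true
  ∈-toSubset S s s∈ = trans (≡-sym (restrict-toSubset S s)) ([]=⇒lookup s∈)

  toSubset-∈ : ∀ S s → S s ≡ true → enc s ∈ toSubset S
  toSubset-∈ S s Ss = restrict⇒∈ (trans (restrict-toSubset S s) Ss)

  irredundant⇒ : ∀ D → Irredundant graph D → IrredundantV (restrict D)
  irredundant⇒ D irr s s∈ with irr (enc s) (restrict⇒∈ s∈)
  ... | w , near , alone =
    dec w , subst (λ x → NbhdV x (dec w)) (dec∘enc s) (nbhd⇒ near) ,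
    λ s′ s′∈ s′≢s near′ → alone (enc s′) (restrict⇒∈ s′∈) (s′≢s ∘ enc-injective)
      (nbhd⇐ (subst (λ x → NbhdV x (dec w)) (≡-sym (dec∘enc s′)) near′))

  irredundant⇐ : ∀ D → IrredundantV (restrict D) → Irredundant graph D
  irredundant⇐ D irr v v∈ with irr (dec v) (∈⇒restrict v∈)
  ... | t , near , alone =
    enc t , nbhd⇐ (subst (NbhdV (dec v)) (≡-sym (dec∘enc t)) near) ,
    λ u u∈ u≢v near′ → alone (dec u) (∈⇒restrict u∈) (u≢v ∘ dec-injective)
      (subst (NbhdV (dec u)) (dec∘enc t) (nbhd⇒ near′))
    where
    dec-injective : ∀ {u v} → dec u ≡ dec v → u ≡ v
    dec-injective {u} {v} e = trans (≡-sym (enc∘dec u)) (trans (cong enc e) (enc∘dec v))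

∈─⇒∉ : ∀ {N} {p q : Subset N} {x} → x ∈ p ─ q → x ∉ q
∈─⇒∉ {p = a ∷ p} {true  ∷ q} {zero}  ()
∈─⇒∉ {p = a ∷ p} {false ∷ q} {zero}  _           ()
∈─⇒∉ {p = a ∷ p} {b     ∷ q} {suc x} (there x∈) (there x∈q) = ∈─⇒∉ x∈ x∈q

exchange-keeps : ∀ {N} {D : Subset N} {u v w} → w ∈ D → w ≢ u → w ∈ (D - u) ∪ ⁅ v ⁆
exchange-keeps w∈ w≢u = x∈p∪q⁺ (inj₁ (x∈p∧x≢y⇒x∈p-y w∈ w≢u))

exchange-new : ∀ {N} (D : Subset N) u v → v ∈ (D - u) ∪ ⁅ v ⁆
exchange-new D u v = x∈p∪q⁺ (inj₂ (x∈⁅x⁆ v))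

exchange-old : ∀ {N} (D : Subset N) {u v w} → w ∈ (D - u) ∪ ⁅ v ⁆ → w ≢ v → (w ∈ D) × (w ≢ u)
exchange-old D {u} {v} w∈ w≢v with x∈p∪q⁻ (D - u) ⁅ v ⁆ w∈
... | inj₁ w∈D-u = p─q⊆p D ⁅ u ⁆ w∈D-u , x∉⁅y⁆⇒x≢y (∈─⇒∉ w∈D-u)
... | inj₂ w∈⁅v⁆ = ⊥-elim (w≢v (x∈⁅y⁆⇒x≡y v w∈⁅v⁆))

module Construction (H : Graph) (P : Split H) (m : ℕ) where
  open Split P
  open ≡-Reasoning

  n : ℕ
  n = order H

  data Vtx : Set where
    X : Fin n → Vtx
    C : Bool → Fin m → Vtx

  X-injective : ∀ {k k′} → X k ≡ X k′ → k ≡ k′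
  X-injective refl = refl

  C-colour : ∀ {r r′ j j′} → C r j ≡ C r′ j′ → r ≡ r′
  C-colour refl = refl

  enc : Vtx → Fin (n + (m + m))
  enc (X i)       = i ↑ˡ (m + m)
  enc (C true j)  = n ↑ʳ (j ↑ˡ m)
  enc (C false j) = n ↑ʳ (m ↑ʳ j)

  dec : Fin (n + (m + m)) → Vtx
  dec v with splitAt n v
  ... | inj₁ i = X i
  ... | inj₂ w with splitAt m w
  ...   | inj₁ j = C true j
  ...   | inj₂ j = C false j

  dec∘enc : ∀ s → dec (enc s) ≡ s
  dec∘enc (X i) rewrite splitAt-↑ˡ n i (m + m) = refl
  dec∘enc (C true j) rewrite splitAt-↑ʳ n (m + m) (j ↑ˡ m) | splitAt-↑ˡ m j m = refl
  dec∘enc (C false j) rewrite splitAt-↑ʳ n (m + m) (m ↑ʳ j) | splitAt-↑ʳ m m j = refl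

  enc∘dec : ∀ v → enc (dec v) ≡ v
  enc∘dec v with splitAt n v in e
  ... | inj₁ i = splitAt⁻¹-↑ˡ e
  ... | inj₂ w with splitAt m w in e′
  ...   | inj₁ j = trans (cong (n ↑ʳ_) (splitAt⁻¹-↑ˡ e′)) (splitAt⁻¹-↑ʳ e)
  ...   | inj₂ j = trans (cong (n ↑ʳ_) (splitAt⁻¹-↑ʳ e′)) (splitAt⁻¹-↑ʳ e)

  -- Adjacency in G: two clique vertices are adjacent iff exactly one of
  -- "same clique", "same index" holds.
  adjV : Vtx → Vtx → Bool
  adjV (X i)   (X k)     = adj H i k ∨ not (does (side i ≟ᵇ side k))
  adjV (X i)   (C r j)   = does (side i ≟ᵇ r)
  adjV (C r j) (X i)     = does (side i ≟ᵇ r)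
  adjV (C r j) (C r′ j′) = does (r ≟ᵇ r′) xor does (j ≟ j′)

  adjV-sym : ∀ s t → adjV s t ≡ adjV t s
  adjV-sym (X i)   (X k)     = cong₂ (λ a b → a ∨ not b) (Graph.sym H i k) (does-sym _≟ᵇ_ (side i) (side k))
  adjV-sym (X i)   (C r j)   = refl
  adjV-sym (C r j) (X i)     = refl
  adjV-sym (C r j) (C r′ j′) = cong₂ _xor_ (does-sym _≟ᵇ_ r r′) (does-sym _≟_ j j′)

  adjV-irrefl : ∀ s → adjV s s ≡ false
  adjV-irrefl (X i)   rewrite irrefl H i | dec-true (side i ≟ᵇ side i) refl = refl
  adjV-irrefl (C r j) rewrite dec-true (r ≟ᵇ r) refl | dec-true (j ≟ j) refl = refl

  open Presented enc dec dec∘enc enc∘dec adjV adjV-sym adjV-irrefl public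

  clique-edge : ∀ r {j j′} → j ≢ j′ → adjV (C r j) (C r j′) ≡ true
  clique-edge r {j} {j′} j≢j′ rewrite dec-true (r ≟ᵇ r) refl | dec-false (j ≟ j′) j≢j′ = refl

  matching-edge : ∀ r j → adjV (C r j) (C (not r) j) ≡ true
  matching-edge r j rewrite dec-false (r ≟ᵇ not r) r≢not-r | dec-true (j ≟ j) refl = refl

  clique-adj : ∀ {r r′ j j′} → adjV (C r j) (C r′ j′) ≡ true →
    (r ≡ r′ × j ≢ j′) ⊎ (r′ ≡ not r × j ≡ j′)
  clique-adj {r} {r′} {j} {j′} e with r ≟ᵇ r′ | j ≟ j′
  ... | yes r≡r′ | no j≢j′  = inj₁ (r≡r′ , j≢j′)
  ... | no r≢r′  | yes j≡j′ = inj₂ (¬-not (r≢r′ ∘ ≡-sym) , j≡j′)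
  clique-adj () | yes _ | yes _
  clique-adj () | no _  | no _

  attach-edge : ∀ {i r} j → side i ≡ r → adjV (C r j) (X i) ≡ true
  attach-edge {i} {r} j si≡r = dec-true (side i ≟ᵇ r) si≡r

  attach-adj : ∀ {i r} j → adjV (X i) (C r j) ≡ true → side i ≡ r
  attach-adj {i} {r} j = does-sound (side i ≟ᵇ r)

  join-edge : ∀ {i k} → side i ≢ side k → adjV (X i) (X k) ≡ true
  join-edge {i} {k} si≢sk rewrite dec-false (side i ≟ᵇ side k) si≢sk = ∨-zeroʳ (adj H i k)

  same-side-adj : ∀ {i k} → side i ≡ side k → adjV (X i) (X k) ≡ adj H i k
  same-side-adj {i} {k} si≡sk rewrite dec-true (side i ≟ᵇ side k) si≡sk = ∨-identityʳ (adj H i k)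

  -- The canonical set of i: the copy X i together with the clique on its side.
  -- These are the IR-sets of G.
  canon : Fin n → Vtx → Bool
  canon i (X k)   = does (k ≟ i)
  canon i (C r j) = does (r ≟ᵇ side i)

  opposite : ∀ b → ∃[ o ] side o ≡ not b
  opposite true  = false-vertex , false-side
  opposite false = true-vertex , true-side

  -- X i has a private neighbour on the other side of H; C r j has its
  -- matching partner C (not r) j.
  canon-irredundant : ∀ i → IrredundantV (canon i)
  canon-irredundant i (X k) k∈ with does-sound (k ≟ i) k∈
  ... | refl = X o , inj₂ (join-edge λ e → r≢not-r (trans e so)) , alone
    where
    o : Fin n
    o = proj₁ (opposite (side i))
    so : side o ≡ not (side i)
    so = proj₂ (opposite (side i))
    alone : ∀ s → canon i s ≡ true → s ≢ X i → ¬ NbhdV s (X o)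
    alone (X k′)  k′∈ s≢ _ with does-sound (k′ ≟ i) k′∈
    ... | refl = s≢ refl
    alone (C r j) r∈  _  (inj₂ a) =
      r≢not-r (trans (≡-sym (does-sound (r ≟ᵇ side i) r∈)) (trans (≡-sym (attach-adj j a)) so))
  canon-irredundant i (C r j) r∈ with does-sound (r ≟ᵇ side i) r∈
  ... | refl = C (not r) j , inj₂ (matching-edge r j) , alone
    where
    alone : ∀ s → canon i s ≡ true → s ≢ C r j → ¬ NbhdV s (C (not r) j)
    alone (X k) k∈ _ (inj₂ a) with does-sound (k ≟ i) k∈
    ... | refl = r≢not-r (attach-adj j a)
    alone (C r′ j′) r′∈ s≢ near with does-sound (r′ ≟ᵇ side i) r′∈
    alone (C r′ j′) r′∈ s≢ (inj₁ e) | refl = r≢not-r (≡-sym (C-colour e))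
    alone (C r′ j′) r′∈ s≢ (inj₂ a) | refl with clique-adj {side i} {not (side i)} {j′} {j} a
    ... | inj₁ (r≡not-r , _) = r≢not-r r≡not-r
    ... | inj₂ (_ , refl)    = s≢ refl

  size : (Vtx → Bool) → ℕ
  size D = count (D ∘ X) + (count (D ∘ C true) + count (D ∘ C false))

  size-by : ∀ D r → size D ≡ count (D ∘ X) + (count (D ∘ C r) + count (D ∘ C (not r)))
  size-by D true  = refl
  size-by D false = cong (count (D ∘ X) +_) (+-comm (count (D ∘ C true)) (count (D ∘ C false)))

  size-cong : ∀ {D D′} → (∀ s → D s ≡ D′ s) → size D ≡ size D′
  size-cong D≗D′ = cong₂ _+_ (count-cong (D≗D′ ∘ X))
    (cong₂ _+_ (count-cong (D≗D′ ∘ C true)) (count-cong (D≗D′ ∘ C false)))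

  canon-size : ∀ i → size (canon i) ≡ suc m
  canon-size i = begin
    size (canon i)                                          ≡⟨ size-by (canon i) (side i) ⟩
    count (canon i ∘ X) + (count (canon i ∘ C (side i)) + count (canon i ∘ C (not (side i))))
      ≡⟨ cong₂ _+_ copies (cong₂ _+_ own other) ⟩
    1 + (m + 0)                                             ≡⟨ cong suc (+-identityʳ m) ⟩
    suc m                                                   ∎
    where
    copies : count (canon i ∘ X) ≡ 1
    copies = ≤-antisym
      (count-≤1 (canon i ∘ X) λ k k′ k∈ k′∈ → trans (does-sound (k ≟ i) k∈) (≡-sym (does-sound (k′ ≟ i) k′∈)))
      (count-≥1 (canon i ∘ X) i (dec-true (i ≟ i) refl))
    own : count (canon i ∘ C (side i)) ≡ m
    own = count-all (canon i ∘ C (side i)) λ _ → dec-true (side i ≟ᵇ side i) refl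
    other : count (canon i ∘ C (not (side i))) ≡ 0
    other = count-none (canon i ∘ C (not (side i))) λ _ → dec-false (not (side i) ≟ᵇ side i) (r≢not-r ∘ ≡-sym)

  clique-near : ∀ r j j′ → NbhdV (C r j) (C r j′)
  clique-near r j j′ with j ≟ j′
  ... | yes refl = inj₁ refl
  ... | no _ rewrite dec-true (r ≟ᵇ r) refl = inj₂ refl

  clique-cover : ∀ r {j j′} t → j ≢ j′ → NbhdV (C r j) t → t ≡ C (not r) j ⊎ NbhdV (C r j′) t
  clique-cover r t j≢j′ (inj₁ refl) = inj₂ (inj₂ (clique-edge r (j≢j′ ∘ ≡-sym)))
  clique-cover r (X i) j≢j′ (inj₂ a) = inj₂ (inj₂ a)
  clique-cover r {j} {j′} (C r″ j″) j≢j′ (inj₂ a) with clique-adj {r} {r″} {j} {j″} a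
  ... | inj₂ (refl , refl) = inj₁ refl
  ... | inj₁ (refl , _) = inj₂ (clique-near r j′ j″)

  copy-cover : ∀ r {i i′} j t → side i ≡ r → side i′ ≡ r →
    NbhdV (X i) t → NbhdV (C r j) t ⊎ NbhdV (X i′) t
  copy-cover r j t si si′ (inj₁ refl) = inj₁ (inj₂ (attach-edge j si))
  copy-cover r j (X k) si si′ (inj₂ a) with bool-cases (side k) r
  ... | inj₁ sk = inj₁ (inj₂ (attach-edge j sk))
  ... | inj₂ sk = inj₂ (inj₂ (join-edge λ e → r≢not-r (trans (≡-sym si′) (trans e sk))))
  copy-cover r j (C r″ j″) si si′ (inj₂ a) with trans (≡-sym (attach-adj j″ a)) si
  ... | refl = inj₁ (clique-near r j j″)

  record Concentrated (D : Vtx → Bool) (r : Bool) : Set where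
    field
      avoids   : ∀ j → D (C (not r) j) ≡ false
      one-copy : ∀ i i′ → D (X i) ≡ true → D (X i′) ≡ true → i ≡ i′
      on-side  : ∀ i → D (X i) ≡ true → side i ≡ r

  -- An irredundant set meeting a clique twice is concentrated on its side:
  -- the private neighbour of C r j must be C (not r) j, which shuts out the
  -- opposite clique and the copies on the opposite side; then the private
  -- neighbour of a copy X i is already dominated unless X i is the only copy.
  clique-pair⇒concentrated : ∀ {D} → IrredundantV D → ∀ r {j j′} → j ≢ j′ →
    D (C r j) ≡ true → D (C r j′) ≡ true → Concentrated D r
  clique-pair⇒concentrated {D} irr r {j} {j′} j≢j′ j∈ j′∈ =
    record { avoids = avoids ; one-copy = one-copy ; on-side = on-side }
    where
    partner-alone : ∀ s → D s ≡ true → s ≢ C r j → ¬ NbhdV s (C (not r) j)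
    partner-alone with irr (C r j) j∈
    ... | t , near , alone with clique-cover r t j≢j′ near
    ...   | inj₁ refl = alone
    ...   | inj₂ near′ = ⊥-elim (alone (C r j′) j′∈ (λ { refl → j≢j′ refl }) near′)

    avoids : ∀ k → D (C (not r) k) ≡ false
    avoids k = ¬-not λ k∈ → partner-alone (C (not r) k) k∈ (r≢not-r ∘ ≡-sym ∘ C-colour) near
      where
      near : NbhdV (C (not r) k) (C (not r) j)
      near = clique-near (not r) k j

    on-side : ∀ i → D (X i) ≡ true → side i ≡ r
    on-side i i∈ with bool-cases (side i) r
    ... | inj₁ si = si
    ... | inj₂ si = ⊥-elim (partner-alone (X i) i∈ (λ ()) (inj₂ (attach-edge j si)))

    one-copy : ∀ i i′ → D (X i) ≡ true → D (X i′) ≡ true → i ≡ i′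
    one-copy i i′ i∈ i′∈ with i ≟ i′
    ... | yes i≡i′ = i≡i′
    ... | no i≢i′ with irr (X i) i∈
    ...   | t , near , alone with copy-cover r j t (on-side i i∈) (on-side i′ i′∈) near
    ...     | inj₁ nearC = ⊥-elim (alone (C r j) j∈ (λ ()) nearC)
    ...     | inj₂ nearX = ⊥-elim (alone (X i′) i′∈ (λ { refl → i≢i′ refl }) nearX)

  Bounded : (Vtx → Bool) → Set
  Bounded D = (size D ≤ suc m) × (size D ≡ suc m → ∃[ i ] (∀ s → D s ≡ canon i s))

  concentrated-bound : ∀ {D r} → Concentrated D r → Bounded D
  concentrated-bound {D} {r} c = ≤-trans (≤-reflexive size≡) (+-mono-≤ copies≤1 (count-≤ (D ∘ C r))) , tight
    where
    open Concentrated c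
    copies≤1 : count (D ∘ X) ≤ 1
    copies≤1 = count-≤1 (D ∘ X) one-copy

    size≡ : size D ≡ count (D ∘ X) + count (D ∘ C r)
    size≡ = begin
      size D
        ≡⟨ size-by D r ⟩
      count (D ∘ X) + (count (D ∘ C r) + count (D ∘ C (not r)))
        ≡⟨ cong (λ z → count (D ∘ X) + (count (D ∘ C r) + z)) (count-none (D ∘ C (not r)) avoids) ⟩
      count (D ∘ X) + (count (D ∘ C r) + 0)
        ≡⟨ cong (count (D ∘ X) +_) (+-identityʳ (count (D ∘ C r))) ⟩
      count (D ∘ X) + count (D ∘ C r)
        ∎

    clique-side : ∀ {r′ j} → D (C r′ j) ≡ true → r′ ≡ r
    clique-side {r′} {j} j∈ with bool-cases r′ r
    ... | inj₁ r′≡r = r′≡r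
    ... | inj₂ refl with trans (≡-sym (avoids j)) j∈
    ...   | ()

    tight : size D ≡ suc m → ∃[ i ] (∀ s → D s ≡ canon i s)
    tight e with sum-tight copies≤1 (count-≤ (D ∘ C r)) (trans (≡-sym size≡) e)
    ... | one , full with count-witness (D ∘ X) (≤-reflexive (≡-sym one))
    ...   | i , i∈ = i , λ s → bool-ext (member⇒canon s) (canon⇒member s)
      where
      member⇒canon : ∀ s → D s ≡ true → canon i s ≡ true
      member⇒canon (X k)   k∈ = dec-true (k ≟ i) (one-copy k i k∈ i∈)
      member⇒canon (C r′ j) j∈ = dec-true (r′ ≟ᵇ side i) (trans (clique-side j∈) (≡-sym (on-side i i∈)))

      canon⇒member : ∀ s → canon i s ≡ true → D s ≡ true
      canon⇒member (X k) k∈ with does-sound (k ≟ i) k∈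
      ... | refl = i∈
      canon⇒member (C r′ j) r′∈ with trans (does-sound (r′ ≟ᵇ side i) r′∈) (on-side i i∈)
      ... | refl = count-full (D ∘ C r) (≤-reflexive (≡-sym full)) j

  spread-bound : ∀ D → count (D ∘ C true) ≤ 1 → count (D ∘ C false) ≤ 1 → size D ≤ n + 2
  spread-bound D t≤1 f≤1 = +-mono-≤ (count-≤ (D ∘ X)) (+-mono-≤ t≤1 f≤1)

  crowded-bound : ∀ {D} → IrredundantV D → ∀ r → 2 ≤ count (D ∘ C r) → Bounded D
  crowded-bound {D} irr r two with count-two (D ∘ C r) two
  ... | j , j′ , j≢j′ , j∈ , j′∈ = concentrated-bound (clique-pair⇒concentrated irr r j≢j′ j∈ j′∈)

  -- The upper bound: an irredundant set either meets some clique twice and is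
  -- concentrated, or meets each clique at most once and is small.
  irredundant-bound : n + 2 ≤ m → ∀ {D} → IrredundantV D → Bounded D
  irredundant-bound big {D} irr with 2 ≤? count (D ∘ C true) | 2 ≤? count (D ∘ C false)
  ... | yes two | _       = crowded-bound irr true two
  ... | no _    | yes two = crowded-bound irr false two
  ... | no t≰ | no f≰   = ≤-trans small (n≤1+n m) , λ e → ⊥-elim (<⇒≱ (n<1+n m) (subst (_≤ m) e small))
    where
    at-most-one : ∀ {x} → ¬ 2 ≤ x → x ≤ 1
    at-most-one 2≰x = s≤s⁻¹ (≰⇒> 2≰x)
    small : size D ≤ m
    small = ≤-trans (spread-bound D (at-most-one t≰) (at-most-one f≰)) big

  ∣∣≡size : ∀ D → ∣ D ∣ ≡ size (restrict D)
  ∣∣≡size D = begin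
    ∣ D ∣
      ≡⟨ ∣∣≡count D ⟩
    count (lookup D)
      ≡⟨ count-split n (lookup D) ⟩
    count (restrict D ∘ X) + count (lookup D ∘ (n ↑ʳ_))
      ≡⟨ cong (count (restrict D ∘ X) +_) (count-split m (lookup D ∘ (n ↑ʳ_))) ⟩
    size (restrict D)
      ∎

  irSet : Fin n → Subset (n + (m + m))
  irSet i = toSubset (canon i)

  irSet-size : ∀ i → ∣ irSet i ∣ ≡ suc m
  irSet-size i = trans (∣∣≡size (irSet i)) (trans (size-cong (restrict-toSubset (canon i))) (canon-size i))

  copy∈irSet : ∀ i → enc (X i) ∈ irSet i
  copy∈irSet i = toSubset-∈ (canon i) (X i) (dec-true (i ≟ i) refl)

  clique∈irSet : ∀ i j → enc (C (side i) j) ∈ irSet i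
  clique∈irSet i j = toSubset-∈ (canon i) (C (side i) j) (dec-true (side i ≟ᵇ side i) refl)

  irSet∋copy : ∀ i {k} → enc (X k) ∈ irSet i → k ≡ i
  irSet∋copy i {k} k∈ = does-sound (k ≟ i) (∈-toSubset (canon i) (X k) k∈)

  irSet∋clique : ∀ i {r j} → enc (C r j) ∈ irSet i → r ≡ side i
  irSet∋clique i {r} {j} j∈ = does-sound (r ≟ᵇ side i) (∈-toSubset (canon i) (C r j) j∈)

  copy≢clique : ∀ i r j → enc (X i) ≢ enc (C r j)
  copy≢clique i r j e with enc-injective {X i} {C r j} e
  ... | ()

  irSet-injective : ∀ i j → irSet i ≡ irSet j → i ≡ j
  irSet-injective i j e = irSet∋copy j (subst (enc (X i) ∈_) e (copy∈irSet i))

  irSet-exchange : ∀ {i j} → side i ≡ side j → irSet j ≡ (irSet i - enc (X i)) ∪ ⁅ enc (X j) ⁆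
  irSet-exchange {i} {j} si≡sj = ⊆-antisym (λ {w} → by-vertex into w) (λ {w} → by-vertex out-of w)
    where
    E : Subset (n + (m + m))
    E = (irSet i - enc (X i)) ∪ ⁅ enc (X j) ⁆
    into : ∀ s → enc s ∈ irSet j → enc s ∈ E
    into (X k) k∈ with irSet∋copy j k∈
    ... | refl = exchange-new (irSet i) (enc (X i)) (enc (X j))
    into (C r z) z∈ with trans (irSet∋clique j {r} {z} z∈) (≡-sym si≡sj)
    ... | refl = exchange-keeps (clique∈irSet i z) (copy≢clique i (side i) z ∘ ≡-sym)
    out-of : ∀ s → enc s ∈ E → enc s ∈ irSet j
    out-of (X k) k∈ with k ≟ j
    ... | yes refl = copy∈irSet j
    ... | no k≢j with exchange-old (irSet i) k∈ (k≢j ∘ X-injective ∘ enc-injective)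
    ...   | k∈i , k≢i with irSet∋copy i k∈i
    ...     | refl = ⊥-elim (k≢i refl)
    out-of (C r z) z∈ with exchange-old (irSet i) z∈ (copy≢clique j r z ∘ ≡-sym)
    ... | z∈i , _ with trans (irSet∋clique i {r} {z} z∈i) si≡sj
    ...   | refl = clique∈irSet j z

  module _ (big : n + 2 ≤ m) where

    irredundant-size : ∀ D → Irredundant graph D → ∣ D ∣ ≤ suc m
    irredundant-size D irr = subst (_≤ suc m) (≡-sym (∣∣≡size D))
      (proj₁ (irredundant-bound big (irredundant⇒ D irr)))

    irSet-IR : ∀ i → IRSet graph (irSet i)
    irSet-IR i =
      irredundant⇐ (irSet i) (IrredundantV-cong (≡-sym ∘ restrict-toSubset (canon i)) (canon-irredundant i)) ,
      λ D irr → subst (∣ D ∣ ≤_) (≡-sym (irSet-size i)) (irredundant-size D irr)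

    -- An IR-set has m + 1 vertices, so the bound is attained and it is canonical.
    IR⇒irSet : ∀ D → IRSet graph D → ∃[ i ] irSet i ≡ D
    IR⇒irSet D (irr , maximum) with proj₂ (irredundant-bound big (irredundant⇒ D irr)) (begin
        size (restrict D) ≡⟨ ≡-sym (∣∣≡size D) ⟩
        ∣ D ∣             ≡⟨ ≤-antisym (irredundant-size D irr)
                               (subst (_≤ ∣ D ∣) (irSet-size true-vertex)
                                 (maximum (irSet true-vertex) (proj₁ (irSet-IR true-vertex)))) ⟩
        suc m             ∎)
    ... | i , D≗canon = i , toSubset-restrict D≗canon

    some-index : Fin m
    some-index = fromℕ< (≤-trans (s≤s z≤n) (≤-trans (m≤n+m 2 n) big))

    IRAdj⇒Adj : ∀ i j → IRAdj graph (irSet i) (irSet j) → Adj H i j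
    IRAdj⇒Adj i j (u , v , u∈ , v∈ , uv , E) = begin
      adj H i j         ≡⟨ ≡-sym (same-side-adj same-side) ⟩
      adjV (X i) (X j)  ≡⟨ ≡-sym (adj-enc (X i) (X j)) ⟩
      adj graph (enc (X i)) (enc (X j)) ≡⟨ cong₂ (adj graph) (≡-sym u≡Xi) (≡-sym v≡Xj) ⟩
      adj graph u v     ≡⟨ uv ⟩
      true              ∎
      where
      u≢v : u ≢ v
      u≢v refl with trans (≡-sym (irrefl graph u)) uv
      ... | ()
      kept : ∀ {w} → w ∈ irSet i → w ≢ u → w ∈ irSet j
      kept w∈ w≢u = subst (_ ∈_) (≡-sym E) (exchange-keeps w∈ w≢u)
      u∉ : ¬ u ∈ irSet j
      u∉ u∈j = proj₂ (exchange-old (irSet i) (subst (u ∈_) E u∈j) u≢v) refl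
      u≡Xi : u ≡ enc (X i)
      u≡Xi with u ≟ enc (X i)
      ... | yes u≡ = u≡
      ... | no u≢ with irSet∋copy j (kept (copy∈irSet i) (u≢ ∘ ≡-sym))
      ...   | refl = ⊥-elim (u∉ u∈)
      v≡Xj : v ≡ enc (X j)
      v≡Xj with v ≟ enc (X j)
      ... | yes v≡ = v≡
      ... | no v≢ with exchange-old (irSet i) (subst (_ ∈_) E (copy∈irSet j)) (v≢ ∘ ≡-sym)
      ...   | Xj∈i , Xj≢u with irSet∋copy i Xj∈i
      ...     | refl = ⊥-elim (Xj≢u (≡-sym u≡Xi))
      same-side : side i ≡ side j
      same-side = irSet∋clique j (kept (clique∈irSet i some-index)
                    λ e → copy≢clique i (side i) some-index (≡-sym (trans e u≡Xi)))

    -- Conversely an edge ij of H lies inside one side, so X i may be exchanged for X j.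
    Adj⇒IRAdj : ∀ i j → Adj H i j → IRAdj graph (irSet i) (irSet j)
    Adj⇒IRAdj i j ij = enc (X i) , enc (X j) , copy∈irSet i , copy∈irSet j ,
      trans (adj-enc (X i) (X j)) (trans (same-side-adj (side-edge i j ij)) ij) ,
      irSet-exchange (side-edge i j ij)

    IR-graph≅H : IRGraphIso graph H
    IR-graph≅H =
      irSet , irSet-IR , irSet-injective , IR⇒irSet , λ i j → mk⇔ (Adj⇒IRAdj i j) (IRAdj⇒Adj i j)

≅⇒order≡ : ∀ {G G′} → G ≅ G′ → order G ≡ order G′
≅⇒order≡ iso = ≤-antisym (injective⇒≤ to-injective) (injective⇒≤ from-injective)
  where
  open _≅_ iso
  to-injective : ∀ {x y} → to x ≡ to y → x ≡ y
  to-injective {x} {y} e = trans (≡-sym (from∘to x)) (trans (cong from e) (from∘to y))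
  from-injective : ∀ {x y} → from x ≡ from y → x ≡ y
  from-injective {x} {y} e = trans (≡-sym (to∘from x)) (trans (cong to e) (to∘from y))

double-injective : ∀ a b → a + a ≡ b + b → a ≡ b
double-injective zero    zero    _ = refl
double-injective (suc a) (suc b) e = cong suc (double-injective a b
  (ℕ-suc-injective (trans (≡-sym (+-suc a a)) (trans (ℕ-suc-injective e) (+-suc b b)))))

-- The k-th graph uses cliques of size n + 2 + k; distinct k give distinct
-- orders n + 2(n + 2 + k), hence non-isomorphic graphs.
theorem3p1 : (H : Graph) → Disconnected H →
    Σ (ℕ → Graph) λ G →
      (∀ i j → i ≢ j → ¬ (G i ≅ G j)) × (∀ i → IRGraphIso (G i) H)
theorem3p1 H dis =
  G , non-isomorphic , λ k → Construction.IR-graph≅H H split (clique k) (m≤m+n (order H + 2) k)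
  where
  split : Split H
  split = disconnected⇒split H dis
  clique : ℕ → ℕ
  clique k = order H + 2 + k
  G : ℕ → Graph
  G k = Construction.graph H split (clique k)
  non-isomorphic : ∀ i j → i ≢ j → ¬ (G i ≅ G j)
  non-isomorphic i j i≢j iso = i≢j (+-cancelˡ-≡ (order H + 2) i j
    (double-injective (clique i) (clique j) (+-cancelˡ-≡ (order H) _ _ (≅⇒order≡ iso))))
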